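{- Let $(\mathcal{GO}_1,\dots,\mathcal{GO}_n)$ be a MinMax optimization problem with $\mathcal{GO}_i=\langle t_i,\prec,\phi_i\rangle$ (all with the same order $\prec$), and let $\mathcal{I}$ be a $\mathcal{GO}_{\mathcal{MINMAX}}$-solution, where $\mathcal{GO}_{\mathcal{MINMAX}}=\langle \mathit{tup}(t_1,\dots,t_n),\prec_{\mathcal{MNMX}},\phi_1\wedge\dots\wedge\phi_n\rangle$. Then $\mathcal{I}$ is a solution to the MinMax problem $(\mathcal{GO}_1,\dots,\mathcal{GO}_n)$.
   Context: Fix a many-sorted first-order theory $\mathcal{T}$ (including a tuple datatype with constructor $\mathit{tup}$); all interpretations are $\mathcal{T}$-interpretations assigning values to all variables. A GOMT problem is a triple $\langle t,\prec,\phi\rangle$ with $t$ a term of sort $\sigma$, $\prec$ a strict partial order on values of sort $\sigma$ definable in $\mathcal{T}$, and $\phi$ a formula; $\mathcal{I}$ is consistent with it if $\mathcal{I}\models\phi$. For a problem $\langle t,\prec',\phi\rangle$, a solution is an interpretation $\mathcal{I}\models\phi$ such that there is no $\mathcal{I}'\models\phi$ with $t^{\mathcal{I}'}\prec' t^{\mathcal{I}}$. $\preccurlyeq$ denotes the reflexive closure of $\prec$. A MinMax problem is a sequence $(\mathcal{GO}_1,\dots,\mathcal{GO}_n)$ of GOMT problems $\mathcal{GO}_i=\langle t_i,\prec,\phi_i\rangle$ sharing the order $\prec$. $\mathcal{I}$ MinMax-dominates $\mathcal{I}'$ if both are $\mathcal{GO}_i$-consistent for every $i$, and $t_{max}^{\mathcal{I}}\prec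 t_{max}^{\mathcal{I}'}$, where $t_{max}^{\mathcal{I}}=t_i^{\mathcal{I}}$ for some $i$ and $t_{max}^{\mathcal{I}'}=t_j^{\mathcal{I}'}$ for some $j$ with $t_k^{\mathcal{I}}\preccurlyeq t_{max}^{\mathcal{I}}$ and $t_k^{\mathcal{I}'}\preccurlyeq t_{max}^{\mathcal{I}'}$ for all $k\in[1,n]$. $\mathcal{I}$ is a solution to the MinMax problem iff it is $\mathcal{GO}_i$-consistent for each $i$ and no interpretation MinMax-dominates it. $(a_1,\dots,a_n)\prec_{\mathcal{MNMX}}(b_1,\dots,b_n)$ iff for some $i,j\in[1,n]$: $a_k\preccurlyeq a_i$ and $b_k\preccurlyeq b_j$ for all $k\in[1,n]$, and $a_i\prec b_j$. -}

module Defs where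

open import Level using (Level; _⊔_)
open import Data.Nat using (ℕ)
open import Data.Fin using (Fin)
open import Data.Product using (Σ; ∃; ∃-syntax; _×_; _,_)
open import Data.Sum using (_⊎_)
open import Relation.Nullary using (¬_)
open import Relation.Binary.Core using (Rel)
open import Relation.Binary.PropositionalEquality using (_≡_)

-- An abstract collection 𝕀 of (T-)interpretations, a sort
-- of values V with a strict partial order _≺_.  A term t of sort V is
-- modelled by its evaluation map 𝕀 → V, a formula φ by its satisfaction
-- predicate 𝕀 → Set (I ⊨ φ).

_≼[_]_ : ∀ {a ℓ} {V : Set a} → V → Rel V ℓ → V → Set (a ⊔ ℓ)
x ≼[ _≺_ ] y = (x ≡ y) ⊎ (x ≺ y)

record GOMT {i v ℓ p : Level} (𝕀 : Set i) (V : Set v) : Set (i ⊔ v ⊔ Level.suc ℓ ⊔ Level.suc p) where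
  constructor ⟨_,_,_⟩
  field
    term    : 𝕀 → V
    order   : Rel V ℓ
    formula : 𝕀 → Set p

Consistent : ∀ {i v ℓ p} {𝕀 : Set i} {V : Set v} → GOMT {ℓ = ℓ} {p = p} 𝕀 V → 𝕀 → Set p
Consistent GO I = GOMT.formula GO I

IsSolution : ∀ {i v ℓ p} {𝕀 : Set i} {V : Set v} → GOMT {ℓ = ℓ} {p = p} 𝕀 V → 𝕀 → Set (i ⊔ ℓ ⊔ p)
IsSolution GO I =
  GOMT.formula GO I ×
  ¬ (Σ _ λ I′ → GOMT.formula GO I′ × GOMT.order GO (GOMT.term GO I′) (GOMT.term GO I))

Tuple : ∀ {v} → Set v → ℕ → Set v
Tuple V n = Fin n → V

tup : ∀ {i v} {𝕀 : Set i} {V : Set v} {n : ℕ} → (Fin n → 𝕀 → V) → 𝕀 → Tuple V n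
tup ts I k = ts k I

_≺MNMX[_]_ : ∀ {v ℓ} {V : Set v} {n : ℕ} → Tuple V n → Rel V ℓ → Tuple V n → Set (v ⊔ ℓ)
_≺MNMX[_]_ {n = n} a _≺_ b =
  ∃[ i ] ∃[ j ] ((∀ k → a k ≼[ _≺_ ] a i) × (∀ k → b k ≼[ _≺_ ] b j) × (a i ≺ b j))

-- A MinMax problem: n GOMT problems sharing the order _≺_
-- (given by terms ts and formulas φs over a common order).
-- I is consistent with every GO_i
AllConsistent : ∀ {i p} {𝕀 : Set i} {n : ℕ} → (Fin n → 𝕀 → Set p) → 𝕀 → Set p
AllConsistent φs I = ∀ k → φs k I

MinMaxDominates : ∀ {i v ℓ p} {𝕀 : Set i} {V : Set v} {n : ℕ} →
  Rel V ℓ → (Fin n → 𝕀 → V) → (Fin n → 𝕀 → Set p) → 𝕀 → 𝕀 → Set (v ⊔ ℓ ⊔ p)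
MinMaxDominates _≺_ ts φs I I′ =
  AllConsistent φs I × AllConsistent φs I′ ×
  ∃[ i ] ∃[ j ] ((∀ k → ts k I ≼[ _≺_ ] ts i I) × (∀ k → ts k I′ ≼[ _≺_ ] ts j I′) ×
                 (ts i I ≺ ts j I′))

IsMinMaxSolution : ∀ {i v ℓ p} {𝕀 : Set i} {V : Set v} {n : ℕ} →
  Rel V ℓ → (Fin n → 𝕀 → V) → (Fin n → 𝕀 → Set p) → 𝕀 → Set (i ⊔ v ⊔ ℓ ⊔ p)
IsMinMaxSolution _≺_ ts φs I =
  AllConsistent φs I × ¬ (Σ _ λ I′ → MinMaxDominates _≺_ ts φs I′ I)

GO-MINMAX : ∀ {i v ℓ p} {𝕀 : Set i} {V : Set v} {n : ℕ} →
  Rel V ℓ → (Fin n → 𝕀 → V) → (Fin n → 𝕀 → Set p) → GOMT {ℓ = v ⊔ ℓ} {p = p} 𝕀 (Tuple V n)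
GO-MINMAX _≺_ ts φs = ⟨ tup ts , (λ a b → a ≺MNMX[ _≺_ ] b) , AllConsistent φs ⟩

module Submission where

open import Defs
open import Level using (Level)
open import Data.Nat using (ℕ)
open import Data.Fin using (Fin)
open import Data.Product using (_,_)
open import Relation.Binary.Core using (Rel)
open import Relation.Binary.PropositionalEquality using (_≡_)
open import Relation.Binary.Structures using (IsStrictPartialOrder)

-- A MinMax dominator of I is consistent with φ₁ ∧ … ∧ φₙ and improves tup(t₁,…,tₙ)
-- in ≺MNMX, so it would contradict I being a GO-MINMAX solution.

dominates⇒tup-≺MNMX : ∀ {i v ℓ p} {𝕀 : Set i} {V : Set v} {n : ℕ}
  (_≺_ : Rel V ℓ) (ts : Fin n → 𝕀 → V) (φs : Fin n → 𝕀 → Set p) {I I′ : 𝕀} →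
  MinMaxDominates _≺_ ts φs I I′ → tup ts I ≺MNMX[ _≺_ ] tup ts I′
dominates⇒tup-≺MNMX _≺_ ts φs (_ , _ , mnmx) = mnmx

proposition3 : ∀ {i v ℓ p : Level} {𝕀 : Set i} {V : Set v}
    (_≺_ : Rel V ℓ) → IsStrictPartialOrder _≡_ _≺_ →
    (n : ℕ) (ts : Fin n → 𝕀 → V) (φs : Fin n → 𝕀 → Set p) (I : 𝕀) →
    IsSolution (GO-MINMAX _≺_ ts φs) I →
    IsMinMaxSolution _≺_ ts φs I
proposition3 _≺_ _ n ts φs I (consistent , noImprovement) =
  consistent , λ { (I′ , dom@(consistent′ , _)) →
    noImprovement (I′ , consistent′ , dominates⇒tup-≺MNMX _≺_ ts φs dom) }
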